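{- Let $\{G_n^*(x)\}$ be a generalized Fibonacci polynomial sequence of Lucas type and $\alpha=2/G_0^*(x)$. Let $m,n,r,q$ be positive integers. (1) If $m\le n$, then $G^*_{m+n}(x)=\alpha G^*_m(x)G^*_n(x)+(-1)^{m+1}g(x)^mG^*_{n-m}(x)$. (2) If $r<m$, then, with $t=\lceil q/2\rceil$, there is a polynomial $T(x)\in\mathbb{Z}[x]$ such that $G^*_{mq+r}(x)=G^*_m(x)T(x)+(-1)^{m(t-1)+t+r}g(x)^{(t-1)m+r}G^*_{m-r}(x)$ if $q$ is odd, and $G^*_{mq+r}(x)=G^*_m(x)T(x)+(-1)^{(m+1)t}g(x)^{mt}G^*_r(x)$ if $q$ is even. (3) If $n>1$, then there is a polynomial $T_n(x)\in\mathbb{Z}[x]$ such that $G^*_{2^nr}(x)=G^*_r(x)T_n(x)+(2/\alpha)g(x)^{2^{n-1}r}$.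
   Context: All polynomials lie in $\mathbb{Z}[x]$. A generalized Fibonacci polynomial (GFP) sequence $\{G_n(x)\}_{n\ge0}$ is given by $G_0(x)=p_0(x)$, $G_1(x)=p_1(x)$ and $G_n(x)=d(x)G_{n-1}(x)+g(x)G_{n-2}(x)$ for $n\ge 2$, where $p_0(x)$ is a constant and $p_1(x),d(x),g(x)$ are nonzero polynomials in $\mathbb{Z}[x]$ with $\gcd(d(x),g(x))=1$; as in the paper it is assumed that $d(x)^2+4g(x)>0$. Let $a,b$ be the roots of $z^2-d(x)z-g(x)=0$. The sequence is of Lucas type if $p_0\ne 0$, $2p_1(x)=p_0\,d(x)$, $|p_0|\in\{1,2\}$, and $\gcd(p_0,p_1(x))=\gcd(p_0,d(x))=\gcd(p_0,g(x))=1$; then, with $\alpha=2/p_0$, $G_n=(a^n+b^n)/\alpha$ (denoted $G_n^*$). -}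

module Defs where

open import Data.Nat as ℕ using (ℕ; zero; suc)
open import Data.Integer as ℤ using (ℤ; +_; 0ℤ; 1ℤ)
open import Data.List using (List; []; _∷_)
open import Data.Product using (Σ; ∃; _×_; _,_)
open import Relation.Binary.PropositionalEquality using (_≡_)
open import Relation.Nullary using (¬_)

-- Polynomials in ℤ[x], represented by coefficient lists (constant term first).
-- Two representations denote the same polynomial iff all coefficients agree
-- (missing coefficients are 0), see _≈_ below.
Poly : Set
Poly = List ℤ

coeff : Poly → ℕ → ℤ
coeff []       _       = 0ℤ
coeff (a ∷ p)  zero    = a
coeff (a ∷ p)  (suc i) = coeff p i

infix 4 _≈_
_≈_ : Poly → Poly → Set
p ≈ q = ∀ i → coeff p i ≡ coeff q i

C : ℤ → Poly
C c = c ∷ []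

infixl 6 _+ₚ_
infixl 7 _*ₚ_
infixr 8 _^ₚ_

_+ₚ_ : Poly → Poly → Poly
[]      +ₚ q       = q
(a ∷ p) +ₚ []      = a ∷ p
(a ∷ p) +ₚ (b ∷ q) = (a ℤ.+ b) ∷ (p +ₚ q)

scale : ℤ → Poly → Poly
scale c []      = []
scale c (a ∷ p) = (c ℤ.* a) ∷ scale c p

_*ₚ_ : Poly → Poly → Poly
[]      *ₚ q = []
(a ∷ p) *ₚ q = scale a q +ₚ (0ℤ ∷ (p *ₚ q))

_^ₚ_ : Poly → ℕ → Poly
p ^ₚ zero  = C 1ℤ
p ^ₚ suc n = p *ₚ (p ^ₚ n)

signPow : ℕ → Poly
signPow zero    = C 1ℤ
signPow (suc k) = scale (ℤ.- 1ℤ) (signPow k)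

infix 4 _∣ₚ_
_∣ₚ_ : Poly → Poly → Set
h ∣ₚ p = ∃ λ k → p ≈ h *ₚ k

CoprimeP : Poly → Poly → Set
CoprimeP p q = ∀ h → h ∣ₚ p → h ∣ₚ q → h ∣ₚ C 1ℤ

NonzeroP : Poly → Set
NonzeroP p = ¬ (p ≈ [])

-- p > 0 in the standard ordering of ℤ[x]: p is nonzero with positive
-- leading coefficient
PositiveP : Poly → Set
PositiveP p = ∃ λ n → (+ 0 ℤ.< coeff p n) × (∀ i → n ℕ.< i → coeff p i ≡ 0ℤ)

G : ℤ → Poly → Poly → Poly → ℕ → Poly
G p₀ p₁ d g zero          = C p₀
G p₀ p₁ d g (suc zero)    = p₁
G p₀ p₁ d g (suc (suc n)) = d *ₚ G p₀ p₁ d g (suc n) +ₚ g *ₚ G p₀ p₁ d g n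

IsGFP : ℤ → Poly → Poly → Poly → Set
IsGFP p₀ p₁ d g =
  NonzeroP p₁ × NonzeroP d × NonzeroP g × CoprimeP d g ×
  PositiveP (d *ₚ d +ₚ C (+ 4) *ₚ g)

IsLucasType : ℤ → Poly → Poly → Poly → Set
IsLucasType p₀ p₁ d g =
  ¬ (p₀ ≡ 0ℤ) × (C (+ 2) *ₚ p₁ ≈ C p₀ *ₚ d) ×
  (ℤ.∣ p₀ ∣ ≡ 1 Data.Sum.⊎ ℤ.∣ p₀ ∣ ≡ 2) ×
  CoprimeP (C p₀) p₁ × CoprimeP (C p₀) d × CoprimeP (C p₀) g
  where import Data.Sum

-- Everything follows from the product formula
--   α G*ᵢ G*ᵢ₊ₖ = G*₂ᵢ₊ₖ + (-g)ⁱ G*ₖ,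
-- proved by a two-step induction on i: the case i + 2 is d times the case
-- (i + 1, k + 1) plus g times the case (i, k + 2), and the base cases are
-- α p₀ = 2 and α p₁ = d (the latter is 2p₁ = p₀ d with the factor 2 cancelled).
-- Read with k = n - m it is (1). Modulo G*ₘ it says G*₂ₘ₊ₖ ≡ -(-g)ᵐ G*ₖ; iterating
-- this ⌊q/2⌋ times reduces G*ₘq₊ᵣ to G*ᵣ (q even) or to G*ₘ₊ᵣ ≡ -(-g)ʳ G*ₘ₋ᵣ (q odd),
-- which is (2). For (3), the formula with i = s, k = 0 reads G*₂ₛ = α (G*ₛ)² - (-g)ˢ p₀:
-- if G*ₛ ≡ ±p₀ g^(s/2) modulo G*ᵣ with s even, then G*₂ₛ ≡ (α p₀ - 1) p₀ gˢ = p₀ gˢ,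
-- and the induction on n starts from s = 2r, where G*₂ᵣ ≡ -(-g)ʳ p₀.
module Submission where

open import Algebra.Bundles using (CommutativeRing; CommutativeMonoid)
open import Level using (0ℓ; _⊔_)

module RingCongruence {c ℓ} (R : CommutativeRing c ℓ) where

  open CommutativeRing R
  open import Algebra.Properties.CommutativeSemigroup *-commutativeSemigroup using (x∙yz≈y∙xz)
  open import Relation.Binary.Reasoning.Setoid setoid

  infix 4 _≈_mod_
  record _≈_mod_ (x y h : Carrier) : Set (c ⊔ ℓ) where
    constructor _,_
    field
      quotient      : Carrier
      decomposition : x ≈ h * quotient + y

  ≈⇒≈mod : ∀ {h x y} → x ≈ y → x ≈ y mod h
  ≈⇒≈mod {h} {x} {y} x≈y = 0# , (begin
    x          ≈⟨ x≈y ⟩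
    y          ≈⟨ +-identityˡ y ⟨
    0# + y     ≈⟨ +-congʳ (zeroʳ h) ⟨
    h * 0# + y ∎)

  ≈mod-trans : ∀ {h x y z} → x ≈ y mod h → y ≈ z mod h → x ≈ z mod h
  ≈mod-trans {h} {x} {y} {z} (s , x≈hs+y) (t , y≈ht+z) = (s + t) , (begin
    x                   ≈⟨ x≈hs+y ⟩
    h * s + y           ≈⟨ +-congˡ y≈ht+z ⟩
    h * s + (h * t + z) ≈⟨ +-assoc (h * s) (h * t) z ⟨
    h * s + h * t + z   ≈⟨ +-congʳ (distribˡ h s t) ⟨
    h * (s + t) + z     ∎)

  ≈mod-respʳ : ∀ {h x y z} → x ≈ y mod h → y ≈ z → x ≈ z mod h
  ≈mod-respʳ x≈y y≈z = ≈mod-trans x≈y (≈⇒≈mod y≈z)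

  ≈mod-*-congˡ : ∀ {h x y} z → x ≈ y mod h → z * x ≈ z * y mod h
  ≈mod-*-congˡ {h} {x} {y} z (t , x≈ht+y) = (z * t) , (begin
    z * x               ≈⟨ *-congˡ x≈ht+y ⟩
    z * (h * t + y)     ≈⟨ distribˡ z (h * t) y ⟩
    z * (h * t) + z * y ≈⟨ +-congʳ (x∙yz≈y∙xz z h t) ⟩
    h * (z * t) + z * y ∎)

  ≈mod-*-congʳ : ∀ {h x y} z → x ≈ y mod h → x * z ≈ y * z mod h
  ≈mod-*-congʳ {x = x} {y} z x≈y =
    ≈mod-respʳ (≈mod-trans (≈⇒≈mod (*-comm x z)) (≈mod-*-congˡ z x≈y)) (*-comm z y)

  ≈mod-*-cong : ∀ {h x y u v} → x ≈ y mod h → u ≈ v mod h → x * u ≈ y * v mod h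
  ≈mod-*-cong {y = y} {u} x≈y u≈v = ≈mod-trans (≈mod-*-congʳ u x≈y) (≈mod-*-congˡ y u≈v)

  ≈mod-+-congʳ : ∀ {h x y} z → x ≈ y mod h → x + z ≈ y + z mod h
  ≈mod-+-congʳ {h} {x} {y} z (t , x≈ht+y) = t , trans (+-congʳ x≈ht+y) (+-assoc (h * t) y z)

-- Imported only now: inside RingCongruence these would clash with the ring's _+_, _*_, _≈_.
open import Data.List using ([]; _∷_)
open import Data.Maybe using (Maybe; just; nothing)
open import Data.Nat using (ℕ; zero; suc; s≤s; _+_; _*_; _∸_; _^_; _≤_; _<_; _%_; ⌈_/2⌉; ⌊_/2⌋)
import Data.Nat.Properties as ℕ
open import Data.Nat.Tactic.RingSolver using (solve-∀)
open import Data.Integer using (ℤ; +_; 0ℤ; 1ℤ; -1ℤ)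
import Data.Integer as ℤ
import Data.Integer.Properties as ℤ
open import Data.Product using (∃; _×_; _,_)
open import Relation.Binary.Bundles using (Setoid)
open import Relation.Binary.PropositionalEquality as ≡ using (_≡_; refl; cong; cong₂)
open import Relation.Nullary using (yes; no)
import Algebra.Solver.Ring
open import Algebra.Solver.Ring.AlmostCommutativeRing
  using (AlmostCommutativeRing; fromCommutativeRing; _-Raw-AlmostCommutative⟶_)
import Relation.Binary.Reasoning.Setoid

open import Defs

coeff-+ₚ : ∀ p q i → coeff (p +ₚ q) i ≡ coeff p i ℤ.+ coeff q i
coeff-+ₚ []      q       i       = ≡.sym (ℤ.+-identityˡ (coeff q i))
coeff-+ₚ (a ∷ p) []      i       = ≡.sym (ℤ.+-identityʳ (coeff (a ∷ p) i))
coeff-+ₚ (a ∷ p) (b ∷ q) zero    = refl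
coeff-+ₚ (a ∷ p) (b ∷ q) (suc i) = coeff-+ₚ p q i

coeff-scale : ∀ c p i → coeff (scale c p) i ≡ c ℤ.* coeff p i
coeff-scale c []      i       = ≡.sym (ℤ.*-zeroʳ c)
coeff-scale c (a ∷ p) zero    = refl
coeff-scale c (a ∷ p) (suc i) = coeff-scale c p i

-- A record around _≈_, so that p and q can be inferred from a proof of p ≋ q.
infix 4 _≋_
record _≋_ (p q : Poly) : Set where
  constructor mk≋
  field ≋⇒≈ : p ≈ q
open _≋_ public

≋-refl : ∀ {p} → p ≋ p
≋-refl = mk≋ λ _ → refl

≋-sym : ∀ {p q} → p ≋ q → q ≋ p
≋-sym (mk≋ p≈q) = mk≋ λ i → ≡.sym (p≈q i)

≋-trans : ∀ {p q r} → p ≋ q → q ≋ r → p ≋ r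
≋-trans (mk≋ p≈q) (mk≋ q≈r) = mk≋ λ i → ≡.trans (p≈q i) (q≈r i)

≋-setoid : Setoid 0ℓ 0ℓ
≋-setoid = record
  { Carrier = Poly
  ; _≈_ = _≋_
  ; isEquivalence = record { refl = ≋-refl ; sym = ≋-sym ; trans = ≋-trans }
  }

module ≋-Reasoning = Relation.Binary.Reasoning.Setoid ≋-setoid

∷-cong : ∀ {a b p q} → a ≡ b → p ≋ q → a ∷ p ≋ b ∷ q
∷-cong a≡b (mk≋ p≈q) = mk≋ λ { zero → a≡b ; (suc i) → p≈q i }

+ₚ-cong : ∀ {p p′ q q′} → p ≋ p′ → q ≋ q′ → p +ₚ q ≋ p′ +ₚ q′
+ₚ-cong {p} {p′} {q} {q′} (mk≋ p≈p′) (mk≋ q≈q′) = mk≋ coeffwise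
  where
  coeffwise : ∀ i → coeff (p +ₚ q) i ≡ coeff (p′ +ₚ q′) i
  coeffwise i rewrite coeff-+ₚ p q i | coeff-+ₚ p′ q′ i = cong₂ ℤ._+_ (p≈p′ i) (q≈q′ i)

+ₚ-assoc : ∀ p q r → (p +ₚ q) +ₚ r ≋ p +ₚ (q +ₚ r)
+ₚ-assoc p q r = mk≋ coeffwise
  where
  coeffwise : ∀ i → coeff ((p +ₚ q) +ₚ r) i ≡ coeff (p +ₚ (q +ₚ r)) i
  coeffwise i rewrite coeff-+ₚ (p +ₚ q) r i | coeff-+ₚ p q i | coeff-+ₚ p (q +ₚ r) i | coeff-+ₚ q r i =
    ℤ.+-assoc (coeff p i) (coeff q i) (coeff r i)

+ₚ-comm : ∀ p q → p +ₚ q ≋ q +ₚ p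
+ₚ-comm p q = mk≋ coeffwise
  where
  coeffwise : ∀ i → coeff (p +ₚ q) i ≡ coeff (q +ₚ p) i
  coeffwise i rewrite coeff-+ₚ p q i | coeff-+ₚ q p i = ℤ.+-comm (coeff p i) (coeff q i)

+ₚ-identityʳ : ∀ p → p +ₚ [] ≋ p
+ₚ-identityʳ p = mk≋ λ i → ≡.trans (coeff-+ₚ p [] i) (ℤ.+-identityʳ (coeff p i))

infix 8 -ₚ_
-ₚ_ : Poly → Poly
-ₚ_ = scale -1ℤ

scale-cong : ∀ c {p q} → p ≋ q → scale c p ≋ scale c q
scale-cong c {p} {q} (mk≋ p≈q) = mk≋ coeffwise
  where
  coeffwise : ∀ i → coeff (scale c p) i ≡ coeff (scale c q) i
  coeffwise i rewrite coeff-scale c p i | coeff-scale c q i = cong (c ℤ.*_) (p≈q i)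

-ₚ-inverseˡ : ∀ p → -ₚ p +ₚ p ≋ []
-ₚ-inverseˡ p = mk≋ coeffwise
  where
  coeffwise : ∀ i → coeff (-ₚ p +ₚ p) i ≡ 0ℤ
  coeffwise i rewrite coeff-+ₚ (-ₚ p) p i | coeff-scale -1ℤ p i | ℤ.-1*i≡-i (coeff p i) =
    ℤ.+-inverseˡ (coeff p i)

-ₚ-inverseʳ : ∀ p → p +ₚ -ₚ p ≋ []
-ₚ-inverseʳ p = ≋-trans (+ₚ-comm p (-ₚ p)) (-ₚ-inverseˡ p)

scale-+ₚ : ∀ c p q → scale c (p +ₚ q) ≋ scale c p +ₚ scale c q
scale-+ₚ c p q = mk≋ coeffwise
  where
  coeffwise : ∀ i → coeff (scale c (p +ₚ q)) i ≡ coeff (scale c p +ₚ scale c q) i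
  coeffwise i rewrite coeff-scale c (p +ₚ q) i | coeff-+ₚ p q i
                    | coeff-+ₚ (scale c p) (scale c q) i | coeff-scale c p i | coeff-scale c q i =
    ℤ.*-distribˡ-+ c (coeff p i) (coeff q i)

scale-+ : ∀ b c p → scale (b ℤ.+ c) p ≋ scale b p +ₚ scale c p
scale-+ b c p = mk≋ coeffwise
  where
  coeffwise : ∀ i → coeff (scale (b ℤ.+ c) p) i ≡ coeff (scale b p +ₚ scale c p) i
  coeffwise i rewrite coeff-scale (b ℤ.+ c) p i | coeff-+ₚ (scale b p) (scale c p) i
                    | coeff-scale b p i | coeff-scale c p i =
    ℤ.*-distribʳ-+ (coeff p i) b c

scale-scale : ∀ b c p → scale b (scale c p) ≋ scale (b ℤ.* c) p
scale-scale b c p = mk≋ coeffwise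
  where
  coeffwise : ∀ i → coeff (scale b (scale c p)) i ≡ coeff (scale (b ℤ.* c) p) i
  coeffwise i rewrite coeff-scale b (scale c p) i | coeff-scale c p i | coeff-scale (b ℤ.* c) p i =
    ≡.sym (ℤ.*-assoc b c (coeff p i))

scale-0ℤ : ∀ p → scale 0ℤ p ≋ []
scale-0ℤ p = mk≋ λ i → ≡.trans (coeff-scale 0ℤ p i) (ℤ.*-zeroˡ (coeff p i))

scale-1ℤ : ∀ p → scale 1ℤ p ≋ p
scale-1ℤ p = mk≋ λ i → ≡.trans (coeff-scale 1ℤ p i) (ℤ.*-identityˡ (coeff p i))

[]≋0∷[] : [] ≋ 0ℤ ∷ []
[]≋0∷[] = mk≋ λ { zero → refl ; (suc i) → refl }

+ₚ-commutativeMonoid : CommutativeMonoid 0ℓ 0ℓ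
+ₚ-commutativeMonoid = record
  { Carrier = Poly
  ; _≈_ = _≋_
  ; _∙_ = _+ₚ_
  ; ε = []
  ; isCommutativeMonoid = record
    { isMonoid = record
      { isSemigroup = record
        { isMagma = record { isEquivalence = Setoid.isEquivalence ≋-setoid ; ∙-cong = +ₚ-cong }
        ; assoc = +ₚ-assoc
        }
      ; identity = (λ _ → ≋-refl) , +ₚ-identityʳ
      }
    ; comm = +ₚ-comm
    }
  }

open import Algebra.Properties.CommutativeSemigroup
  (CommutativeMonoid.commutativeSemigroup +ₚ-commutativeMonoid)
  using (x∙yz≈y∙xz; interchange)

*ₚ-congˡ : ∀ p {q q′} → q ≋ q′ → p *ₚ q ≋ p *ₚ q′
*ₚ-congˡ []      q≋q′ = ≋-refl
*ₚ-congˡ (a ∷ p) q≋q′ = +ₚ-cong (scale-cong a q≋q′) (∷-cong refl (*ₚ-congˡ p q≋q′))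

*ₚ-zeroʳ : ∀ p → p *ₚ [] ≋ []
*ₚ-zeroʳ []      = ≋-refl
*ₚ-zeroʳ (a ∷ p) = ≋-trans (∷-cong refl (*ₚ-zeroʳ p)) (≋-sym []≋0∷[])

*ₚ-∷ʳ : ∀ p a q → p *ₚ (a ∷ q) ≋ scale a p +ₚ (0ℤ ∷ p *ₚ q)
*ₚ-∷ʳ []      a q = []≋0∷[]
*ₚ-∷ʳ (b ∷ p) a q = ∷-cong (cong (ℤ._+ 0ℤ) (ℤ.*-comm b a)) (begin
  scale b q +ₚ p *ₚ (a ∷ q)                  ≈⟨ +ₚ-cong ≋-refl (*ₚ-∷ʳ p a q) ⟩
  scale b q +ₚ (scale a p +ₚ (0ℤ ∷ p *ₚ q))  ≈⟨ x∙yz≈y∙xz (scale b q) (scale a p) (0ℤ ∷ p *ₚ q) ⟩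
  scale a p +ₚ (scale b q +ₚ (0ℤ ∷ p *ₚ q))  ∎)
  where open ≋-Reasoning

*ₚ-comm : ∀ p q → p *ₚ q ≋ q *ₚ p
*ₚ-comm []      q = ≋-sym (*ₚ-zeroʳ q)
*ₚ-comm (a ∷ p) q = ≋-trans (+ₚ-cong ≋-refl (∷-cong refl (*ₚ-comm p q))) (≋-sym (*ₚ-∷ʳ q a p))

*ₚ-congʳ : ∀ {p p′} q → p ≋ p′ → p *ₚ q ≋ p′ *ₚ q
*ₚ-congʳ {p} {p′} q p≋p′ = ≋-trans (*ₚ-comm p q) (≋-trans (*ₚ-congˡ q p≋p′) (*ₚ-comm q p′))

*ₚ-cong : ∀ {p p′ q q′} → p ≋ p′ → q ≋ q′ → p *ₚ q ≋ p′ *ₚ q′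
*ₚ-cong {p} {p′} {q} p≋p′ q≋q′ = ≋-trans (*ₚ-congʳ q p≋p′) (*ₚ-congˡ p′ q≋q′)

*ₚ-distribʳ : ∀ r p q → (p +ₚ q) *ₚ r ≋ p *ₚ r +ₚ q *ₚ r
*ₚ-distribʳ r []      q       = ≋-refl
*ₚ-distribʳ r (a ∷ p) []      = ≋-sym (+ₚ-identityʳ ((a ∷ p) *ₚ r))
*ₚ-distribʳ r (a ∷ p) (b ∷ q) = begin
  scale (a ℤ.+ b) r +ₚ (0ℤ ∷ (p +ₚ q) *ₚ r)
    ≈⟨ +ₚ-cong (scale-+ a b r) (∷-cong refl (*ₚ-distribʳ r p q)) ⟩
  (scale a r +ₚ scale b r) +ₚ ((0ℤ ∷ p *ₚ r) +ₚ (0ℤ ∷ q *ₚ r))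
    ≈⟨ interchange (scale a r) (scale b r) (0ℤ ∷ p *ₚ r) (0ℤ ∷ q *ₚ r) ⟩
  (scale a r +ₚ (0ℤ ∷ p *ₚ r)) +ₚ (scale b r +ₚ (0ℤ ∷ q *ₚ r))
    ∎
  where open ≋-Reasoning

*ₚ-distribˡ : ∀ r p q → r *ₚ (p +ₚ q) ≋ r *ₚ p +ₚ r *ₚ q
*ₚ-distribˡ r p q = begin
  r *ₚ (p +ₚ q)         ≈⟨ *ₚ-comm r (p +ₚ q) ⟩
  (p +ₚ q) *ₚ r         ≈⟨ *ₚ-distribʳ r p q ⟩
  p *ₚ r +ₚ q *ₚ r      ≈⟨ +ₚ-cong (*ₚ-comm p r) (*ₚ-comm q r) ⟩
  r *ₚ p +ₚ r *ₚ q      ∎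
  where open ≋-Reasoning

scale-*ₚ : ∀ c p q → scale c p *ₚ q ≋ scale c (p *ₚ q)
scale-*ₚ c []      q = ≋-refl
scale-*ₚ c (a ∷ p) q = begin
  scale (c ℤ.* a) q +ₚ (0ℤ ∷ scale c p *ₚ q)
    ≈⟨ +ₚ-cong (≋-sym (scale-scale c a q)) (∷-cong (≡.sym (ℤ.*-zeroʳ c)) (scale-*ₚ c p q)) ⟩
  scale c (scale a q) +ₚ scale c (0ℤ ∷ p *ₚ q)
    ≈⟨ scale-+ₚ c (scale a q) (0ℤ ∷ p *ₚ q) ⟨
  scale c (scale a q +ₚ (0ℤ ∷ p *ₚ q))
    ∎
  where open ≋-Reasoning

0∷-*ₚ : ∀ p q → (0ℤ ∷ p) *ₚ q ≋ 0ℤ ∷ p *ₚ q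
0∷-*ₚ p q = +ₚ-cong (scale-0ℤ q) ≋-refl

*ₚ-assoc : ∀ p q r → (p *ₚ q) *ₚ r ≋ p *ₚ (q *ₚ r)
*ₚ-assoc []      q r = ≋-refl
*ₚ-assoc (a ∷ p) q r = begin
  (scale a q +ₚ (0ℤ ∷ p *ₚ q)) *ₚ r
    ≈⟨ *ₚ-distribʳ r (scale a q) (0ℤ ∷ p *ₚ q) ⟩
  scale a q *ₚ r +ₚ (0ℤ ∷ p *ₚ q) *ₚ r
    ≈⟨ +ₚ-cong (scale-*ₚ a q r) (≋-trans (0∷-*ₚ (p *ₚ q) r) (∷-cong refl (*ₚ-assoc p q r))) ⟩
  scale a (q *ₚ r) +ₚ (0ℤ ∷ p *ₚ (q *ₚ r))
    ∎
  where open ≋-Reasoning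

C*ₚ≋scale : ∀ c p → C c *ₚ p ≋ scale c p
C*ₚ≋scale c p = ≋-trans (+ₚ-cong ≋-refl (≋-sym []≋0∷[])) (+ₚ-identityʳ (scale c p))

*ₚ-identityˡ : ∀ p → C 1ℤ *ₚ p ≋ p
*ₚ-identityˡ p = ≋-trans (C*ₚ≋scale 1ℤ p) (scale-1ℤ p)

polyRing : CommutativeRing 0ℓ 0ℓ
polyRing = record
  { Carrier = Poly
  ; _≈_ = _≋_
  ; _+_ = _+ₚ_
  ; _*_ = _*ₚ_
  ; -_ = -ₚ_
  ; 0# = []
  ; 1# = C 1ℤ
  ; isCommutativeRing = record
    { isRing = record
      { +-isAbelianGroup = record
        { isGroup = record
          { isMonoid = CommutativeMonoid.isMonoid +ₚ-commutativeMonoid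
          ; inverse = -ₚ-inverseˡ , -ₚ-inverseʳ
          ; ⁻¹-cong = scale-cong -1ℤ
          }
        ; comm = +ₚ-comm
        }
      ; *-cong = *ₚ-cong
      ; *-assoc = *ₚ-assoc
      ; *-identity = *ₚ-identityˡ , λ p → ≋-trans (*ₚ-comm p (C 1ℤ)) (*ₚ-identityˡ p)
      ; distrib = *ₚ-distribˡ , *ₚ-distribʳ
      }
    ; *-comm = *ₚ-comm
    }
  }

C-*ₚ-C : ∀ a b {c} → a ℤ.* b ≡ c → C a *ₚ C b ≋ C c
C-*ₚ-C a b ab≡c = ∷-cong (≡.trans (ℤ.+-identityʳ (a ℤ.* b)) ab≡c) ≋-refl

coeff-C*ₚ : ∀ c p i → coeff (C c *ₚ p) i ≡ c ℤ.* coeff p i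
coeff-C*ₚ c p i = ≡.trans (≋⇒≈ (C*ₚ≋scale c p) i) (coeff-scale c p i)

C*ₚ-cancelˡ : ∀ c {p q} .{{_ : ℤ.NonZero c}} → C c *ₚ p ≋ C c *ₚ q → p ≋ q
C*ₚ-cancelˡ c {p} {q} (mk≋ cp≈cq) = mk≋ λ i → ℤ.*-cancelˡ-≡ c (coeff p i) (coeff q i)
  (≡.trans (≡.sym (coeff-C*ₚ c p i)) (≡.trans (cp≈cq i) (coeff-C*ₚ c q i)))

polyAlmostCommutativeRing : AlmostCommutativeRing 0ℓ 0ℓ
polyAlmostCommutativeRing = fromCommutativeRing polyRing

C-homomorphism : ℤ.+-*-rawRing -Raw-AlmostCommutative⟶ polyAlmostCommutativeRing
C-homomorphism = record
  { ⟦_⟧ = C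
  ; +-homo = λ _ _ → ≋-refl
  ; *-homo = λ a b → ≋-sym (C-*ₚ-C a b refl)
  ; -‿homo = λ a → ∷-cong (≡.sym (ℤ.-1*i≡-i a)) ≋-refl
  ; 0-homo = ≋-sym []≋0∷[]
  ; 1-homo = ≋-refl
  }

C-≟ : ∀ a b → Maybe (C a ≋ C b)
C-≟ a b with a ℤ.≟ b
... | yes refl = just ≋-refl
... | no _     = nothing

module PolySolver = Algebra.Solver.Ring ℤ.+-*-rawRing polyAlmostCommutativeRing C-homomorphism C-≟

open RingCongruence polyRing
open PolySolver using (solve; _:=_; _:+_; _:*_; :-_; con)

^ₚ-+ : ∀ x m n → x ^ₚ (m + n) ≋ x ^ₚ m *ₚ x ^ₚ n
^ₚ-+ x zero    n = ≋-sym (*ₚ-identityˡ (x ^ₚ n))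
^ₚ-+ x (suc m) n = ≋-trans (*ₚ-congˡ x (^ₚ-+ x m n)) (≋-sym (*ₚ-assoc x (x ^ₚ m) (x ^ₚ n)))

signPow-+ : ∀ m n → signPow (m + n) ≋ signPow m *ₚ signPow n
signPow-+ zero    n = ≋-sym (*ₚ-identityˡ (signPow n))
signPow-+ (suc m) n = ≋-trans (scale-cong _ (signPow-+ m n))
  (solve 2 (λ s t → :- (s :* t) := (:- s) :* t) ≋-refl (signPow m) (signPow n))

signPow-square : ∀ n → signPow n *ₚ signPow n ≋ C 1ℤ
signPow-square zero    = *ₚ-identityˡ (C 1ℤ)
signPow-square (suc n) =
  ≋-trans (solve 1 (λ s → (:- s) :* (:- s) := s :* s) ≋-refl (signPow n)) (signPow-square n)

signPow-odd : ∀ n → signPow (n + n + 1) ≋ -ₚ C 1ℤ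
signPow-odd n = begin
  signPow (n + n + 1)                 ≈⟨ signPow-+ (n + n) 1 ⟩
  signPow (n + n) *ₚ signPow 1        ≈⟨ *ₚ-congʳ (signPow 1) (≋-trans (signPow-+ n n) (signPow-square n)) ⟩
  C 1ℤ *ₚ signPow 1                   ≈⟨ *ₚ-identityˡ (signPow 1) ⟩
  -ₚ C 1ℤ                             ∎
  where open ≋-Reasoning

signed-power-merge : ∀ x a b c e y →
  signPow a *ₚ x ^ₚ b *ₚ (signPow c *ₚ x ^ₚ e *ₚ y) ≋ signPow (a + c) *ₚ x ^ₚ (b + e) *ₚ y
signed-power-merge x a b c e y = begin
  signPow a *ₚ x ^ₚ b *ₚ (signPow c *ₚ x ^ₚ e *ₚ y)
    ≈⟨ solve 5 (λ s p t q y → s :* p :* (t :* q :* y) := s :* t :* (p :* q) :* y) ≋-refl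
         (signPow a) (x ^ₚ b) (signPow c) (x ^ₚ e) y ⟩
  signPow a *ₚ signPow c *ₚ (x ^ₚ b *ₚ x ^ₚ e) *ₚ y
    ≈⟨ *ₚ-congʳ y (*ₚ-cong (≋-sym (signPow-+ a c)) (≋-sym (^ₚ-+ x b e))) ⟩
  signPow (a + c) *ₚ x ^ₚ (b + e) *ₚ y
    ∎
  where open ≋-Reasoning

power-square : ∀ x b y → (y *ₚ x ^ₚ b) *ₚ (y *ₚ x ^ₚ b) ≋ y *ₚ y *ₚ x ^ₚ (b + b)
power-square x b y = begin
  (y *ₚ x ^ₚ b) *ₚ (y *ₚ x ^ₚ b)
    ≈⟨ solve 2 (λ y p → (y :* p) :* (y :* p) := y :* y :* (p :* p)) ≋-refl y (x ^ₚ b) ⟩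
  y *ₚ y *ₚ (x ^ₚ b *ₚ x ^ₚ b)
    ≈⟨ *ₚ-congˡ (y *ₚ y) (^ₚ-+ x b b) ⟨
  y *ₚ y *ₚ x ^ₚ (b + b)
    ∎
  where open ≋-Reasoning

signed-square : ∀ a x b y →
  (signPow a *ₚ x ^ₚ b *ₚ y) *ₚ (signPow a *ₚ x ^ₚ b *ₚ y) ≋ y *ₚ y *ₚ x ^ₚ (b + b)
signed-square a x b y = begin
  (signPow a *ₚ x ^ₚ b *ₚ y) *ₚ (signPow a *ₚ x ^ₚ b *ₚ y)
    ≈⟨ solve 3 (λ s p y → (s :* p :* y) :* (s :* p :* y) := s :* s :* ((y :* p) :* (y :* p)))
         ≋-refl (signPow a) (x ^ₚ b) y ⟩
  signPow a *ₚ signPow a *ₚ ((y *ₚ x ^ₚ b) *ₚ (y *ₚ x ^ₚ b))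
    ≈⟨ *ₚ-cong (signPow-square a) (power-square x b y) ⟩
  C 1ℤ *ₚ (y *ₚ y *ₚ x ^ₚ (b + b))
    ≈⟨ *ₚ-identityˡ (y *ₚ y *ₚ x ^ₚ (b + b)) ⟩
  y *ₚ y *ₚ x ^ₚ (b + b)
    ∎
  where open ≋-Reasoning

+-regroup : ∀ m n k → m + m + n + k ≡ m + (m + (n + k))
+-regroup = solve-∀

even-multiple-index : ∀ m w r → m * (w + w) + r ≡ w * (m + m) + r
even-multiple-index = solve-∀

odd-multiple-index : ∀ m w r → m * suc (w + w) + r ≡ w * (m + m) + (m + r)
odd-multiple-index = solve-∀

odd-multiple-sign : ∀ m w r → w * (m + 1) + (r + 1) ≡ m * w + suc w + r
odd-multiple-sign = solve-∀

double-power-of-two : ∀ n r → 2 ^ suc n * r ≡ 2 ^ n * r + 2 ^ n * r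
double-power-of-two n = double (2 ^ n)
  where
  double : ∀ x r → 2 * x * r ≡ x * r + x * r
  double = solve-∀

-- The recursive clause type-checks because suc (suc q) % 2 computes to q % 2.
parity-split : ∀ q → q ≡ q % 2 + (⌊ q /2⌋ + ⌊ q /2⌋)
parity-split zero          = refl
parity-split (suc zero)    = refl
parity-split (suc (suc q)) =
  ≡.trans (cong (λ n → suc (suc n)) (parity-split q)) (move-sucs (q % 2) ⌊ q /2⌋)
  where
  move-sucs : ∀ a b → suc (suc (a + (b + b))) ≡ a + (suc b + suc b)
  move-sucs = solve-∀

even⇒double : ∀ q → q % 2 ≡ 0 → ∃ λ w → q ≡ w + w
even⇒double q q-even = ⌊ q /2⌋ , ≡.trans (parity-split q) (cong (_+ (⌊ q /2⌋ + ⌊ q /2⌋)) q-even)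

odd⇒double+1 : ∀ q → q % 2 ≡ 1 → ∃ λ w → q ≡ suc (w + w)
odd⇒double+1 q q-odd = ⌊ q /2⌋ , ≡.trans (parity-split q) (cong (_+ (⌊ q /2⌋ + ⌊ q /2⌋)) q-odd)

module LucasSequence (p₀ α : ℤ) (p₁ d g : Poly)
  (α-p₀ : α ℤ.* p₀ ≡ + 2) (α-p₁ : C α *ₚ p₁ ≋ d) where

  G* : ℕ → Poly
  G* = G p₀ p₁ d g

  open ≋-Reasoning

  α-C-p₀ : C α *ₚ C p₀ ≋ C (+ 2)
  α-C-p₀ = C-*ₚ-C α p₀ α-p₀

  -- (-g)ⁱ is written signPow i *ₚ g ^ₚ i: at suc i both factors unfold definitionally,
  -- so the induction step is a ring identity in the atoms signPow i and g ^ₚ i.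
  ProductFormula : ℕ → ℕ → Set
  ProductFormula i k =
    C α *ₚ G* i *ₚ G* (i + k) ≋ G* (i + (i + k)) +ₚ signPow i *ₚ g ^ₚ i *ₚ G* k

  product-formula-step : ∀ i k →
    ProductFormula (suc i) (suc k) → ProductFormula i (suc (suc k)) → ProductFormula (suc (suc i)) k
  product-formula-step i k pf₁ pf₂ = begin
    C α *ₚ (d *ₚ G* (suc i) +ₚ g *ₚ G* i) *ₚ X
      ≈⟨ solve 6 (λ a d x g y z → a :* (d :* x :+ g :* y) :* z
                                  := d :* (a :* x :* z) :+ g :* (a :* y :* z))
           ≋-refl (C α) d (G* (suc i)) g (G* i) X ⟩
    d *ₚ (C α *ₚ G* (suc i) *ₚ X) +ₚ g *ₚ (C α *ₚ G* i *ₚ X)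
      ≈⟨ +ₚ-cong (*ₚ-congˡ d pf₁′) (*ₚ-congˡ g pf₂′) ⟩
    d *ₚ (G* (suc N) +ₚ -ₚ s *ₚ (g *ₚ P) *ₚ G* (suc k))
      +ₚ g *ₚ (G* N +ₚ s *ₚ P *ₚ (d *ₚ G* (suc k) +ₚ g *ₚ G* k))
      ≈⟨ solve 8 (λ d g y₁ y₀ s p k₁ k₀ →
             d :* (y₁ :+ (:- s) :* (g :* p) :* k₁) :+ g :* (y₀ :+ s :* p :* (d :* k₁ :+ g :* k₀))
               := (d :* y₁ :+ g :* y₀) :+ (:- (:- s)) :* (g :* (g :* p)) :* k₀)
           ≋-refl d g (G* (suc N)) (G* N) s P (G* (suc k)) (G* k) ⟩
    G* (suc (suc N)) +ₚ -ₚ -ₚ s *ₚ (g *ₚ (g *ₚ P)) *ₚ G* k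
      ∎
    where
    X = G* (suc (suc (i + k)))
    N = i + suc (suc (i + k))
    s = signPow i
    P = g ^ₚ i
    pf₁′ : C α *ₚ G* (suc i) *ₚ X ≋ G* (suc N) +ₚ -ₚ s *ₚ (g *ₚ P) *ₚ G* (suc k)
    pf₁′ = ≡.subst
      (λ j → C α *ₚ G* (suc i) *ₚ G* (suc j) ≋ G* (suc (i + suc j)) +ₚ -ₚ s *ₚ (g *ₚ P) *ₚ G* (suc k))
      (ℕ.+-suc i k) pf₁
    pf₂′ : C α *ₚ G* i *ₚ X ≋ G* N +ₚ s *ₚ P *ₚ G* (suc (suc k))
    pf₂′ = ≡.subst
      (λ j → C α *ₚ G* i *ₚ G* j ≋ G* (i + j) +ₚ s *ₚ P *ₚ G* (suc (suc k)))
      (≡.trans (ℕ.+-suc i (suc k)) (cong suc (ℕ.+-suc i k))) pf₂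

  product-formula : ∀ i k → ProductFormula i k
  product-formula zero k = begin
    C α *ₚ C p₀ *ₚ G* k            ≈⟨ *ₚ-congʳ (G* k) α-C-p₀ ⟩
    C (+ 2) *ₚ G* k               ≈⟨ solve 1 (λ x → con (+ 2) :* x := x :+ con 1ℤ :* con 1ℤ :* x)
                                         ≋-refl (G* k) ⟩
    G* k +ₚ C 1ℤ *ₚ C 1ℤ *ₚ G* k   ∎
  product-formula (suc zero) k = begin
    C α *ₚ p₁ *ₚ G* (suc k)
      ≈⟨ *ₚ-congʳ (G* (suc k)) α-p₁ ⟩
    d *ₚ G* (suc k)
      ≈⟨ solve 4 (λ d x g y → d :* x := (d :* x :+ g :* y) :+ (:- con 1ℤ) :* (g :* con 1ℤ) :* y)
           ≋-refl d (G* (suc k)) g (G* k) ⟩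
    G* (suc (suc k)) +ₚ signPow 1 *ₚ g ^ₚ 1 *ₚ G* k
      ∎
  product-formula (suc (suc i)) k =
    product-formula-step i k (product-formula (suc i) (suc k)) (product-formula i (suc (suc k)))

  double-shift : ∀ i k →
    G* (i + (i + k)) ≋ C α *ₚ G* i *ₚ G* (i + k) +ₚ signPow (i + 1) *ₚ g ^ₚ i *ₚ G* k
  double-shift i k rewrite ℕ.+-comm i 1 = begin
    G* (i + (i + k))
      ≈⟨ solve 4 (λ y s p x → y := y :+ s :* p :* x :+ (:- s) :* p :* x)
           ≋-refl (G* (i + (i + k))) (signPow i) (g ^ₚ i) (G* k) ⟩
    G* (i + (i + k)) +ₚ signPow i *ₚ g ^ₚ i *ₚ G* k +ₚ signPow (suc i) *ₚ g ^ₚ i *ₚ G* k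
      ≈⟨ +ₚ-cong (≋-sym (product-formula i k)) ≋-refl ⟩
    C α *ₚ G* i *ₚ G* (i + k) +ₚ signPow (suc i) *ₚ g ^ₚ i *ₚ G* k
      ∎

  addition-formula : ∀ {m n} → m ≤ n →
    G* (m + n) ≋ C α *ₚ G* m *ₚ G* n +ₚ signPow (m + 1) *ₚ g ^ₚ m *ₚ G* (n ∸ m)
  addition-formula {m} {n} m≤n = ≡.subst
    (λ j → G* (m + j) ≋ C α *ₚ G* m *ₚ G* j +ₚ signPow (m + 1) *ₚ g ^ₚ m *ₚ G* (n ∸ m))
    (ℕ.m+[n∸m]≡n m≤n) (double-shift m (n ∸ m))

  shift-mod : ∀ i k → G* (i + (i + k)) ≈ signPow (i + 1) *ₚ g ^ₚ i *ₚ G* k mod G* i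
  shift-mod i k = C α *ₚ G* (i + k) , ≋-trans (double-shift i k)
    (+ₚ-cong (solve 3 (λ a x y → a :* x :* y := x :* (a :* y)) ≋-refl (C α) (G* i) (G* (i + k))) ≋-refl)

  iterated-shift-mod : ∀ m w k →
    G* (w * (m + m) + k) ≈ signPow (w * (m + 1)) *ₚ g ^ₚ (w * m) *ₚ G* k mod G* m
  iterated-shift-mod m zero    k =
    ≈⇒≈mod (solve 1 (λ x → x := con 1ℤ :* con 1ℤ :* x) ≋-refl (G* k))
  iterated-shift-mod m (suc w) k rewrite +-regroup m (w * (m + m)) k =
    ≈mod-trans (shift-mod m (w * (m + m) + k))
      (≈mod-respʳ (≈mod-*-congˡ (signPow (m + 1) *ₚ g ^ₚ m) (iterated-shift-mod m w k))
                  (signed-power-merge g (m + 1) m (w * (m + 1)) (w * m) (G* k)))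

  even-multiple-mod : ∀ m w r →
    G* (m * (w + w) + r) ≈ signPow ((m + 1) * w) *ₚ g ^ₚ (m * w) *ₚ G* r mod G* m
  even-multiple-mod m w r rewrite even-multiple-index m w r | ℕ.*-comm (m + 1) w | ℕ.*-comm m w =
    iterated-shift-mod m w r

  even-quotient-mod : ∀ m r q → q % 2 ≡ 0 →
    G* (m * q + r) ≈ signPow ((m + 1) * ⌈ q /2⌉) *ₚ g ^ₚ (m * ⌈ q /2⌉) *ₚ G* r mod G* m
  even-quotient-mod m r q q-even with even⇒double q q-even
  ... | w , refl rewrite ≡.sym (ℕ.n≡⌈n+n/2⌉ w) = even-multiple-mod m w r

  add-mod : ∀ {m r} → r ≤ m → G* (m + r) ≈ signPow (r + 1) *ₚ g ^ₚ r *ₚ G* (m ∸ r) mod G* m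
  add-mod {m} {r} r≤m with double-shift r (m ∸ r)
  ... | decomposition rewrite ℕ.m+[n∸m]≡n r≤m | ℕ.+-comm r m =
    C α *ₚ G* r , ≋-trans decomposition
      (+ₚ-cong (solve 3 (λ a x y → a :* x :* y := y :* (a :* x)) ≋-refl (C α) (G* r) (G* m)) ≋-refl)

  odd-multiple-mod : ∀ {m r} w → r ≤ m →
    G* (m * suc (w + w) + r) ≈ signPow (m * w + suc w + r) *ₚ g ^ₚ (w * m + r) *ₚ G* (m ∸ r)
      mod G* m
  odd-multiple-mod {m} {r} w r≤m
    rewrite odd-multiple-index m w r | ≡.sym (odd-multiple-sign m w r) =
    ≈mod-trans (iterated-shift-mod m w (m + r))
      (≈mod-respʳ (≈mod-*-congˡ (signPow (w * (m + 1)) *ₚ g ^ₚ (w * m)) (add-mod r≤m))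
                  (signed-power-merge g (w * (m + 1)) (w * m) (r + 1) r (G* (m ∸ r))))

  odd-quotient-mod : ∀ {m r} q → r ≤ m → q % 2 ≡ 1 →
    G* (m * q + r) ≈ signPow (m * (⌈ q /2⌉ ∸ 1) + ⌈ q /2⌉ + r)
                     *ₚ g ^ₚ ((⌈ q /2⌉ ∸ 1) * m + r) *ₚ G* (m ∸ r) mod G* m
  odd-quotient-mod q r≤m q-odd with odd⇒double+1 q q-odd
  ... | w , refl rewrite ≡.sym (ℕ.n≡⌊n+n/2⌋ w) = odd-multiple-mod w r≤m

  doubling-mod : ∀ {h e} s → G* (s + s) ≈ e mod h → e *ₚ e ≋ C p₀ *ₚ C p₀ *ₚ g ^ₚ (s + s) →
    G* ((s + s) + (s + s)) ≈ C p₀ *ₚ g ^ₚ (s + s) mod h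
  doubling-mod {h} {e} s G*≈e e²≋ = ≈mod-respʳ
    (≈mod-trans (≈⇒≈mod square-formula)
      (≈mod-+-congʳ (signPow (t + 1) *ₚ g ^ₚ t *ₚ C p₀) (≈mod-*-cong (≈mod-*-congˡ (C α) G*≈e) G*≈e)))
    collapse
    where
    t = s + s
    square-formula : G* (t + t) ≋ C α *ₚ G* t *ₚ G* t +ₚ signPow (t + 1) *ₚ g ^ₚ t *ₚ C p₀
    square-formula = ≡.subst
      (λ j → G* (t + j) ≋ C α *ₚ G* t *ₚ G* j +ₚ signPow (t + 1) *ₚ g ^ₚ t *ₚ C p₀)
      (ℕ.+-identityʳ t) (double-shift t 0)
    collapse : C α *ₚ e *ₚ e +ₚ signPow (t + 1) *ₚ g ^ₚ t *ₚ C p₀ ≋ C p₀ *ₚ g ^ₚ t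
    collapse = begin
      C α *ₚ e *ₚ e +ₚ signPow (t + 1) *ₚ g ^ₚ t *ₚ C p₀
        ≈⟨ +ₚ-cong (≋-trans (*ₚ-assoc (C α) e e) (*ₚ-congˡ (C α) e²≋))
                   (*ₚ-congʳ (C p₀) (*ₚ-congʳ (g ^ₚ t) (signPow-odd s))) ⟩
      C α *ₚ (C p₀ *ₚ C p₀ *ₚ g ^ₚ t) +ₚ -ₚ C 1ℤ *ₚ g ^ₚ t *ₚ C p₀
        ≈⟨ solve 3 (λ a p x → a :* (p :* p :* x) :+ (:- con 1ℤ) :* x :* p
                                := a :* p :* (p :* x) :+ (:- con 1ℤ) :* (p :* x))
             ≋-refl (C α) (C p₀) (g ^ₚ t) ⟩
      C α *ₚ C p₀ *ₚ (C p₀ *ₚ g ^ₚ t) +ₚ -ₚ C 1ℤ *ₚ (C p₀ *ₚ g ^ₚ t)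
        ≈⟨ +ₚ-cong (*ₚ-congʳ (C p₀ *ₚ g ^ₚ t) α-C-p₀) ≋-refl ⟩
      C (+ 2) *ₚ (C p₀ *ₚ g ^ₚ t) +ₚ -ₚ C 1ℤ *ₚ (C p₀ *ₚ g ^ₚ t)
        ≈⟨ solve 1 (λ y → con (+ 2) :* y :+ (:- con 1ℤ) :* y := y) ≋-refl (C p₀ *ₚ g ^ₚ t) ⟩
      C p₀ *ₚ g ^ₚ t
        ∎

  power-of-two-mod : ∀ {n} r → 1 < n →
    G* (2 ^ n * r) ≈ C p₀ *ₚ g ^ₚ (2 ^ (n ∸ 1) * r) mod G* r
  power-of-two-mod r (s≤s (s≤s {n = k} _)) rewrite double-power-of-two (suc k) r = squares k
    where
    squares : ∀ k → G* (2 ^ suc k * r + 2 ^ suc k * r) ≈ C p₀ *ₚ g ^ₚ (2 ^ suc k * r) mod G* r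
    squares zero rewrite ℕ.+-identityʳ r = doubling-mod r base (signed-square (r + 1) g r (C p₀))
      where
      base : G* (r + r) ≈ signPow (r + 1) *ₚ g ^ₚ r *ₚ C p₀ mod G* r
      base = ≡.subst (λ j → G* (r + j) ≈ signPow (r + 1) *ₚ g ^ₚ r *ₚ C p₀ mod G* r)
        (ℕ.+-identityʳ r) (shift-mod r 0)
    squares (suc k) rewrite double-power-of-two (suc k) r =
      doubling-mod (2 ^ suc k * r) (squares k) (power-square g (2 ^ suc k * r) (C p₀))

lucas-α-p₁ : ∀ {p₀ α p₁ d} → α ℤ.* p₀ ≡ + 2 → C (+ 2) *ₚ p₁ ≈ C p₀ *ₚ d → C α *ₚ p₁ ≋ d
lucas-α-p₁ {p₀} {α} {p₁} {d} α-p₀ 2p₁≈p₀d = C*ₚ-cancelˡ (+ 2) (begin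
  C (+ 2) *ₚ (C α *ₚ p₁)
    ≈⟨ solve 2 (λ a x → con (+ 2) :* (a :* x) := a :* (con (+ 2) :* x)) ≋-refl (C α) p₁ ⟩
  C α *ₚ (C (+ 2) *ₚ p₁)   ≈⟨ *ₚ-congˡ (C α) (mk≋ 2p₁≈p₀d) ⟩
  C α *ₚ (C p₀ *ₚ d)       ≈⟨ *ₚ-assoc (C α) (C p₀) d ⟨
  C α *ₚ C p₀ *ₚ d         ≈⟨ *ₚ-congʳ d (C-*ₚ-C α p₀ α-p₀) ⟩
  C (+ 2) *ₚ d             ∎)
  where open ≋-Reasoning

explicit-quotient : ∀ {x y h} → x ≈ y mod h → ∃ λ T → x ≈ h *ₚ T +ₚ y
explicit-quotient (T , x≋hT+y) = T , ≋⇒≈ x≋hT+y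

proposition7 : (p₀ : ℤ) (p₁ d g : Poly) →
    IsGFP p₀ p₁ d g → IsLucasType p₀ p₁ d g →
    (α : ℤ) → α Data.Integer.* p₀ ≡ + 2 →
    (m n r q : ℕ) → 1 ≤ m → 1 ≤ n → 1 ≤ r → 1 ≤ q →
      (m ≤ n →
        G p₀ p₁ d g (m + n) ≈
          C α *ₚ G p₀ p₁ d g m *ₚ G p₀ p₁ d g n
          +ₚ signPow (m + 1) *ₚ g ^ₚ m *ₚ G p₀ p₁ d g (n ∸ m))
      × (r < m →
          (q % 2 ≡ 1 → ∃ λ T →
            G p₀ p₁ d g (m * q + r) ≈
              G p₀ p₁ d g m *ₚ T
              +ₚ signPow (m * (⌈ q /2⌉ ∸ 1) + ⌈ q /2⌉ + r)
                 *ₚ g ^ₚ ((⌈ q /2⌉ ∸ 1) * m + r) *ₚ G p₀ p₁ d g (m ∸ r))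
          × (q % 2 ≡ 0 → ∃ λ T →
            G p₀ p₁ d g (m * q + r) ≈
              G p₀ p₁ d g m *ₚ T
              +ₚ signPow ((m + 1) * ⌈ q /2⌉)
                 *ₚ g ^ₚ (m * ⌈ q /2⌉) *ₚ G p₀ p₁ d g r))
      × (1 < n → ∃ λ T →
          G p₀ p₁ d g (2 ^ n * r) ≈
            G p₀ p₁ d g r *ₚ T +ₚ C p₀ *ₚ g ^ₚ (2 ^ (n ∸ 1) * r))
proposition7 p₀ p₁ d g _ (_ , 2p₁≈p₀d , _) α α-p₀ m n r q _ _ _ _ =
    (λ m≤n → ≋⇒≈ (addition-formula m≤n))
  , (λ r<m → (λ q-odd → explicit-quotient (odd-quotient-mod q (ℕ.<⇒≤ r<m) q-odd))
           , (λ q-even → explicit-quotient (even-quotient-mod m r q q-even)))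
  , (λ 1<n → explicit-quotient (power-of-two-mod r 1<n))
  where open LucasSequence p₀ α p₁ d g α-p₀ (lucas-α-p₁ α-p₀ 2p₁≈p₀d)
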